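{- For every finite multiset of formulas $\Gamma$ and every formula $\varphi$: if BSC-K$_3\vdash\Gamma\Rightarrow\varphi\mid\ \Rightarrow$ (the bisequent whose 1-sequent is $\Gamma\Rightarrow\varphi$ and whose 2-sequent is empty on both sides), then $\Gamma\models_{\mathbf{K}_3}\varphi$.
   Context: Formulas are built from propositional atoms with connectives $\neg,\wedge,\vee,\rightarrow$. A $\mathbf{K}_3$-valuation is a homomorphism $h$ from formulas to $\{0,u,1\}$ (ordered $0<u<1$) with: $h(\neg\varphi)=1,u,0$ when $h(\varphi)=0,u,1$; $h(\varphi\wedge\psi)=\min(h(\varphi),h(\psi))$; $h(\varphi\vee\psi)=\max(h(\varphi),h(\psi))$; $h(\varphi\rightarrow\psi)=\max(h(\neg\varphi),h(\psi))$. $\Gamma\models_{\mathbf{K}_3}\varphi$ means: for every valuation $h$, if $h(\gamma)=1$ for all $\gamma\in\Gamma$ then $h(\varphi)=1$. A sequent is $\Gamma\Rightarrow\Delta$ with $\Gamma,\Delta$ finite multisets of formulas; a bisequent is an ordered pair of sequents $\Gamma\Rightarrow\Delta\mid\Pi\Rightarrow\Sigma$. A bisequent is axiomatic iff some formula occurs in both $\Gamma$ and $\Sigma$, or in both $\Gamma$ and $\Delta$, or in both $\Pi$ and $\Sigma$. BSC-K$_3\vdash B$ means there is a finite tree of bisequents with root $B$, all of whose leaves are axiomatic, and in which every non-leaf node is the conclusion of an instance of one of the following rules whose premisses are exactly its children ($S$ denotes an arbitrary sequent): $(\neg\Rightarrow\mid)$: from $\Gamma\Rightarrow\Delta\mid\Pi\Rightarrow\Sigma,\varphi$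 infer $\neg\varphi,\Gamma\Rightarrow\Delta\mid\Pi\Rightarrow\Sigma$. $(\Rightarrow\neg\mid)$: from $\Gamma\Rightarrow\Delta\mid\varphi,\Pi\Rightarrow\Sigma$ infer $\Gamma\Rightarrow\Delta,\neg\varphi\mid\Pi\Rightarrow\Sigma$. $(\mid\neg\Rightarrow)$: from $\Gamma\Rightarrow\Delta,\varphi\mid\Pi\Rightarrow\Sigma$ infer $\Gamma\Rightarrow\Delta\mid\neg\varphi,\Pi\Rightarrow\Sigma$. $(\mid\Rightarrow\neg)$: from $\varphi,\Gamma\Rightarrow\Delta\mid\Pi\Rightarrow\Sigma$ infer $\Gamma\Rightarrow\Delta\mid\Pi\Rightarrow\Sigma,\neg\varphi$. $(\wedge\Rightarrow\mid)$: from $\varphi,\psi,\Gamma\Rightarrow\Delta\mid S$ infer $\varphi\wedge\psi,\Gamma\Rightarrow\Delta\mid S$. $(\Rightarrow\wedge\mid)$: from $\Gamma\Rightarrow\Delta,\varphi\mid S$ and $\Gamma\Rightarrow\Delta,\psi\mid S$ infer $\Gamma\Rightarrow\Delta,\varphi\wedge\psi\mid S$. $(\mid\wedge\Rightarrow)$: from $S\mid\varphi,\psi,\Gamma\Rightarrow\Delta$ infer $S\mid\varphi\wedge\psi,\Gamma\Rightarrow\Delta$. $(\mid\Rightarrow\wedge)$: from $S\mid\Gamma\Rightarrow\Delta,\varphi$ and $S\mid\Gamma\Rightarrow\Delta,\psi$ infer $S\mid\Gamma\Rightarrow\Delta,\varphi\wedge\psi$. $(\Rightarrow\vee\mid)$: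 from $\Gamma\Rightarrow\Delta,\varphi,\psi\mid S$ infer $\Gamma\Rightarrow\Delta,\varphi\vee\psi\mid S$. $(\vee\Rightarrow\mid)$: from $\varphi,\Gamma\Rightarrow\Delta\mid S$ and $\psi,\Gamma\Rightarrow\Delta\mid S$ infer $\varphi\vee\psi,\Gamma\Rightarrow\Delta\mid S$. $(\mid\Rightarrow\vee)$: from $S\mid\Gamma\Rightarrow\Delta,\varphi,\psi$ infer $S\mid\Gamma\Rightarrow\Delta,\varphi\vee\psi$. $(\mid\vee\Rightarrow)$: from $S\mid\varphi,\Gamma\Rightarrow\Delta$ and $S\mid\psi,\Gamma\Rightarrow\Delta$ infer $S\mid\varphi\vee\psi,\Gamma\Rightarrow\Delta$. $(\Rightarrow\rightarrow\mid)$: from $\Gamma\Rightarrow\Delta,\psi\mid\varphi,\Pi\Rightarrow\Sigma$ infer $\Gamma\Rightarrow\Delta,\varphi\rightarrow\psi\mid\Pi\Rightarrow\Sigma$. $(\mid\Rightarrow\rightarrow)$: from $\varphi,\Gamma\Rightarrow\Delta\mid\Pi\Rightarrow\Sigma,\psi$ infer $\Gamma\Rightarrow\Delta\mid\Pi\Rightarrow\Sigma,\varphi\rightarrow\psi$. $(\rightarrow\Rightarrow\mid)$: from $\Gamma\Rightarrow\Delta\mid\Pi\Rightarrow\Sigma,\varphi$ and $\psi,\Gamma\Rightarrow\Delta\mid\Pi\Rightarrow\Sigma$ infer $\varphi\rightarrow\psi,\Gamma\Rightarrow\Delta\mid\Pi\Rightarrow\Sigma$. $(\mid\rightarrow\Rightarrow)$: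 from $\Gamma\Rightarrow\Delta,\varphi\mid\Pi\Rightarrow\Sigma$ and $\Gamma\Rightarrow\Delta\mid\psi,\Pi\Rightarrow\Sigma$ infer $\Gamma\Rightarrow\Delta\mid\varphi\rightarrow\psi,\Pi\Rightarrow\Sigma$. -}

module Defs where

open import Data.Nat using (ℕ)
open import Data.List using (List; []; _∷_)
open import Data.List.Membership.Propositional using (_∈_)
open import Data.List.Relation.Binary.Permutation.Propositional using (_↭_)
open import Data.Product using (∃; _×_)
open import Data.Sum using (_⊎_)
open import Relation.Binary.PropositionalEquality using (_≡_)

data Formula : Set where
  atom : ℕ → Formula
  ¬'_  : Formula → Formula
  _∧'_ : Formula → Formula → Formula
  _∨'_ : Formula → Formula → Formula
  _⇒'_ : Formula → Formula → Formula

data V3 : Set where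
  v0 vu v1 : V3

neg3 : V3 → V3
neg3 v0 = v1
neg3 vu = vu
neg3 v1 = v0

min3 : V3 → V3 → V3
min3 v0 _  = v0
min3 vu v0 = v0
min3 vu _  = vu
min3 v1 y  = y

max3 : V3 → V3 → V3
max3 v1 _  = v1
max3 vu v1 = v1
max3 vu _  = vu
max3 v0 y  = y

eval : (ℕ → V3) → Formula → V3
eval v (atom p) = v p
eval v (¬' φ)   = neg3 (eval v φ)
eval v (φ ∧' ψ) = min3 (eval v φ) (eval v ψ)
eval v (φ ∨' ψ) = max3 (eval v φ) (eval v ψ)
eval v (φ ⇒' ψ) = max3 (neg3 (eval v φ)) (eval v ψ)

-- Γ ⊨K3 φ  (Γ a finite multiset, represented as a list)
_⊨K3_ : List Formula → Formula → Set
Γ ⊨K3 φ = (v : ℕ → V3) → (∀ γ → γ ∈ Γ → eval v γ ≡ v1) → eval v φ ≡ v1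

-- Bisequent Γ ⇒ Δ | Π ⇒ Σ; multisets are lists taken up to permutation
infix 4 _⇒_∣_⇒_

record Bisequent : Set where
  constructor _⇒_∣_⇒_
  field
    ant1 suc1 ant2 suc2 : List Formula

Shared : List Formula → List Formula → Set
Shared X Y = ∃ λ φ → φ ∈ X × φ ∈ Y

Axiomatic : Bisequent → Set
Axiomatic (Γ ⇒ Δ ∣ Π ⇒ Σ) = Shared Γ Σ ⊎ Shared Γ Δ ⊎ Shared Π Σ

-- Principal formulas are written at the head of
-- the lists; the constructor 'perm' identifies bisequents whose components
-- are equal as multisets (i.e. permutations of each other), so that every
-- rule applies to a formula at any position of a multiset.
data ⊢BSC : Bisequent → Set where
  ax   : ∀ {B} → Axiomatic B → ⊢BSC B
  perm : ∀ {Γ Γ' Δ Δ' Π Π' Σ Σ'} → Γ ↭ Γ' → Δ ↭ Δ' → Π ↭ Π' → Σ ↭ Σ' →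
         ⊢BSC (Γ ⇒ Δ ∣ Π ⇒ Σ) → ⊢BSC (Γ' ⇒ Δ' ∣ Π' ⇒ Σ')
  ¬L1 : ∀ {Γ Δ Π Σ φ} → ⊢BSC (Γ ⇒ Δ ∣ Π ⇒ φ ∷ Σ) → ⊢BSC ((¬' φ) ∷ Γ ⇒ Δ ∣ Π ⇒ Σ)
  ¬R1 : ∀ {Γ Δ Π Σ φ} → ⊢BSC (Γ ⇒ Δ ∣ φ ∷ Π ⇒ Σ) → ⊢BSC (Γ ⇒ (¬' φ) ∷ Δ ∣ Π ⇒ Σ)
  ¬L2 : ∀ {Γ Δ Π Σ φ} → ⊢BSC (Γ ⇒ φ ∷ Δ ∣ Π ⇒ Σ) → ⊢BSC (Γ ⇒ Δ ∣ (¬' φ) ∷ Π ⇒ Σ)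
  ¬R2 : ∀ {Γ Δ Π Σ φ} → ⊢BSC (φ ∷ Γ ⇒ Δ ∣ Π ⇒ Σ) → ⊢BSC (Γ ⇒ Δ ∣ Π ⇒ (¬' φ) ∷ Σ)
  ∧L1 : ∀ {Γ Δ Π Σ φ ψ} → ⊢BSC (φ ∷ ψ ∷ Γ ⇒ Δ ∣ Π ⇒ Σ) → ⊢BSC ((φ ∧' ψ) ∷ Γ ⇒ Δ ∣ Π ⇒ Σ)
  ∧R1 : ∀ {Γ Δ Π Σ φ ψ} → ⊢BSC (Γ ⇒ φ ∷ Δ ∣ Π ⇒ Σ) → ⊢BSC (Γ ⇒ ψ ∷ Δ ∣ Π ⇒ Σ) →
        ⊢BSC (Γ ⇒ (φ ∧' ψ) ∷ Δ ∣ Π ⇒ Σ)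
  ∧L2 : ∀ {Γ Δ Π Σ φ ψ} → ⊢BSC (Γ ⇒ Δ ∣ φ ∷ ψ ∷ Π ⇒ Σ) → ⊢BSC (Γ ⇒ Δ ∣ (φ ∧' ψ) ∷ Π ⇒ Σ)
  ∧R2 : ∀ {Γ Δ Π Σ φ ψ} → ⊢BSC (Γ ⇒ Δ ∣ Π ⇒ φ ∷ Σ) → ⊢BSC (Γ ⇒ Δ ∣ Π ⇒ ψ ∷ Σ) →
        ⊢BSC (Γ ⇒ Δ ∣ Π ⇒ (φ ∧' ψ) ∷ Σ)
  ∨R1 : ∀ {Γ Δ Π Σ φ ψ} → ⊢BSC (Γ ⇒ φ ∷ ψ ∷ Δ ∣ Π ⇒ Σ) → ⊢BSC (Γ ⇒ (φ ∨' ψ) ∷ Δ ∣ Π ⇒ Σ)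
  ∨L1 : ∀ {Γ Δ Π Σ φ ψ} → ⊢BSC (φ ∷ Γ ⇒ Δ ∣ Π ⇒ Σ) → ⊢BSC (ψ ∷ Γ ⇒ Δ ∣ Π ⇒ Σ) →
        ⊢BSC ((φ ∨' ψ) ∷ Γ ⇒ Δ ∣ Π ⇒ Σ)
  ∨R2 : ∀ {Γ Δ Π Σ φ ψ} → ⊢BSC (Γ ⇒ Δ ∣ Π ⇒ φ ∷ ψ ∷ Σ) → ⊢BSC (Γ ⇒ Δ ∣ Π ⇒ (φ ∨' ψ) ∷ Σ)
  ∨L2 : ∀ {Γ Δ Π Σ φ ψ} → ⊢BSC (Γ ⇒ Δ ∣ φ ∷ Π ⇒ Σ) → ⊢BSC (Γ ⇒ Δ ∣ ψ ∷ Π ⇒ Σ) →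
        ⊢BSC (Γ ⇒ Δ ∣ (φ ∨' ψ) ∷ Π ⇒ Σ)
  →R1 : ∀ {Γ Δ Π Σ φ ψ} → ⊢BSC (Γ ⇒ ψ ∷ Δ ∣ φ ∷ Π ⇒ Σ) → ⊢BSC (Γ ⇒ (φ ⇒' ψ) ∷ Δ ∣ Π ⇒ Σ)
  →R2 : ∀ {Γ Δ Π Σ φ ψ} → ⊢BSC (φ ∷ Γ ⇒ Δ ∣ Π ⇒ ψ ∷ Σ) → ⊢BSC (Γ ⇒ Δ ∣ Π ⇒ (φ ⇒' ψ) ∷ Σ)
  →L1 : ∀ {Γ Δ Π Σ φ ψ} → ⊢BSC (Γ ⇒ Δ ∣ Π ⇒ φ ∷ Σ) → ⊢BSC (ψ ∷ Γ ⇒ Δ ∣ Π ⇒ Σ) →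
        ⊢BSC ((φ ⇒' ψ) ∷ Γ ⇒ Δ ∣ Π ⇒ Σ)
  →L2 : ∀ {Γ Δ Π Σ φ ψ} → ⊢BSC (Γ ⇒ φ ∷ Δ ∣ Π ⇒ Σ) → ⊢BSC (Γ ⇒ Δ ∣ ψ ∷ Π ⇒ Σ) →
        ⊢BSC (Γ ⇒ Δ ∣ (φ ⇒' ψ) ∷ Π ⇒ Σ)

-- A K3 value is determined by two classical bits, "is 1" and "is 0", which
-- are never both set; on these bits the connectives act as in classical
-- logic, negation swapping them.  A valuation refutes Γ ⇒ Δ ∣ Π ⇒ Σ when every
-- formula of Γ is 1, none of Δ is 1, none of Π is 0 and every formula of Σ is
-- 0.  Each rule turns a refutation of its conclusion into one of a premiss,
-- and axiomatic bisequents admit no refutation (for Γ against Σ because no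
-- value is both 1 and 0).  A refutation of Γ ⇒ φ ∣ ⇒ is exactly a valuation
-- making Γ true and φ not true.
module Submission where

open import Defs
open import Data.Bool using (Bool; true; false; _∧_; _∨_)
open import Data.Bool.Properties using (∧-conicalˡ; ∧-conicalʳ; ∨-conicalˡ; ∨-conicalʳ)
open import Data.Empty using (⊥; ⊥-elim)
open import Data.List using (List; []; _∷_)
open import Data.List.Relation.Unary.All as All using (All; []; _∷_)
open import Data.List.Relation.Binary.Permutation.Propositional using (↭-sym)
open import Data.List.Relation.Binary.Permutation.Propositional.Properties using (All-resp-↭)
open import Data.Nat using (ℕ)
open import Data.Product using (_×_; _,_)
open import Data.Sum using (_⊎_; inj₁; inj₂)
open import Relation.Binary.PropositionalEquality using (_≡_; refl; sym; trans; cong; cong₂)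
open import Relation.Nullary using (¬_)

∧-≡-false⁻ : ∀ x {y} → x ∧ y ≡ false → x ≡ false ⊎ y ≡ false
∧-≡-false⁻ false _ = inj₁ refl
∧-≡-false⁻ true  e = inj₂ e

∨-≡-true⁻ : ∀ x {y} → x ∨ y ≡ true → x ≡ true ⊎ y ≡ true
∨-≡-true⁻ true  _ = inj₁ refl
∨-≡-true⁻ false e = inj₂ e

is1 : V3 → Bool
is1 v1 = true
is1 _  = false

is0 : V3 → Bool
is0 v0 = true
is0 _  = false

is1⇒≡v1 : ∀ a → is1 a ≡ true → a ≡ v1
is1⇒≡v1 v1 _ = refl

is1-is0-disjoint : ∀ a → is1 a ≡ true → is0 a ≡ true → ⊥
is1-is0-disjoint v1 _ ()

is1-neg3 : ∀ a → is1 (neg3 a) ≡ is0 a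
is1-neg3 v0 = refl
is1-neg3 vu = refl
is1-neg3 v1 = refl

is0-neg3 : ∀ a → is0 (neg3 a) ≡ is1 a
is0-neg3 v0 = refl
is0-neg3 vu = refl
is0-neg3 v1 = refl

is1-min3 : ∀ a b → is1 (min3 a b) ≡ is1 a ∧ is1 b
is1-min3 v0 b  = refl
is1-min3 vu v0 = refl
is1-min3 vu vu = refl
is1-min3 vu v1 = refl
is1-min3 v1 b  = refl

is0-min3 : ∀ a b → is0 (min3 a b) ≡ is0 a ∨ is0 b
is0-min3 v0 b  = refl
is0-min3 vu v0 = refl
is0-min3 vu vu = refl
is0-min3 vu v1 = refl
is0-min3 v1 b  = refl

is1-max3 : ∀ a b → is1 (max3 a b) ≡ is1 a ∨ is1 b
is1-max3 v1 b  = refl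
is1-max3 vu v0 = refl
is1-max3 vu vu = refl
is1-max3 vu v1 = refl
is1-max3 v0 b  = refl

is0-max3 : ∀ a b → is0 (max3 a b) ≡ is0 a ∧ is0 b
is0-max3 v1 b  = refl
is0-max3 vu v0 = refl
is0-max3 vu vu = refl
is0-max3 vu v1 = refl
is0-max3 v0 b  = refl

holds fails : (ℕ → V3) → Formula → Bool
holds v (atom p) = is1 (v p)
holds v (¬' φ)   = fails v φ
holds v (φ ∧' ψ) = holds v φ ∧ holds v ψ
holds v (φ ∨' ψ) = holds v φ ∨ holds v ψ
holds v (φ ⇒' ψ) = fails v φ ∨ holds v ψ
fails v (atom p) = is0 (v p)
fails v (¬' φ)   = holds v φ
fails v (φ ∧' ψ) = fails v φ ∨ fails v ψ
fails v (φ ∨' ψ) = fails v φ ∧ fails v ψ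
fails v (φ ⇒' ψ) = holds v φ ∧ fails v ψ

is1-eval : ∀ v φ → is1 (eval v φ) ≡ holds v φ
is0-eval : ∀ v φ → is0 (eval v φ) ≡ fails v φ
is1-eval v (atom p) = refl
is1-eval v (¬' φ)   = trans (is1-neg3 (eval v φ)) (is0-eval v φ)
is1-eval v (φ ∧' ψ) = trans (is1-min3 (eval v φ) (eval v ψ)) (cong₂ _∧_ (is1-eval v φ) (is1-eval v ψ))
is1-eval v (φ ∨' ψ) = trans (is1-max3 (eval v φ) (eval v ψ)) (cong₂ _∨_ (is1-eval v φ) (is1-eval v ψ))
is1-eval v (φ ⇒' ψ) = trans (is1-max3 (neg3 (eval v φ)) (eval v ψ))
  (cong₂ _∨_ (trans (is1-neg3 (eval v φ)) (is0-eval v φ)) (is1-eval v ψ))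
is0-eval v (atom p) = refl
is0-eval v (¬' φ)   = trans (is0-neg3 (eval v φ)) (is1-eval v φ)
is0-eval v (φ ∧' ψ) = trans (is0-min3 (eval v φ) (eval v ψ)) (cong₂ _∨_ (is0-eval v φ) (is0-eval v ψ))
is0-eval v (φ ∨' ψ) = trans (is0-max3 (eval v φ) (eval v ψ)) (cong₂ _∧_ (is0-eval v φ) (is0-eval v ψ))
is0-eval v (φ ⇒' ψ) = trans (is0-max3 (neg3 (eval v φ)) (eval v ψ))
  (cong₂ _∧_ (trans (is0-neg3 (eval v φ)) (is1-eval v φ)) (is0-eval v ψ))

holds-fails-disjoint : ∀ v φ → holds v φ ≡ true → fails v φ ≡ true → ⊥
holds-fails-disjoint v φ h f =
  is1-is0-disjoint (eval v φ) (trans (is1-eval v φ) h) (trans (is0-eval v φ) f)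

Refutes : (ℕ → V3) → Bisequent → Set
Refutes v (Γ ⇒ Δ ∣ Π ⇒ Σ) =
  All (λ φ → holds v φ ≡ true) Γ × All (λ φ → holds v φ ≡ false) Δ ×
  All (λ φ → fails v φ ≡ false) Π × All (λ φ → fails v φ ≡ true) Σ

axiomatic-irrefutable : ∀ {B} v → Axiomatic B → ¬ Refutes v B
axiomatic-irrefutable v (inj₁ (φ , i , j)) (g , d , p , s) =
  holds-fails-disjoint v φ (All.lookup g i) (All.lookup s j)
axiomatic-irrefutable v (inj₂ (inj₁ (φ , i , j))) (g , d , p , s)
  with () ← trans (sym (All.lookup g i)) (All.lookup d j)
axiomatic-irrefutable v (inj₂ (inj₂ (φ , i , j))) (g , d , p , s)
  with () ← trans (sym (All.lookup s j)) (All.lookup p i)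

sound : ∀ {B} → ⊢BSC B → ∀ v → ¬ Refutes v B
sound (ax a) v r = axiomatic-irrefutable v a r
sound (perm eΓ eΔ eΠ eΣ D) v (g , d , p , s) = sound D v
  (All-resp-↭ (↭-sym eΓ) g , All-resp-↭ (↭-sym eΔ) d , All-resp-↭ (↭-sym eΠ) p , All-resp-↭ (↭-sym eΣ) s)
sound (¬L1 D) v (x ∷ g , d , p , s) = sound D v (g , d , p , x ∷ s)
sound (¬R1 D) v (g , x ∷ d , p , s) = sound D v (g , d , x ∷ p , s)
sound (¬L2 D) v (g , d , x ∷ p , s) = sound D v (g , x ∷ d , p , s)
sound (¬R2 D) v (g , d , p , x ∷ s) = sound D v (x ∷ g , d , p , s)
sound (∧L1 D) v (x ∷ g , d , p , s) =
  sound D v (∧-conicalˡ _ _ x ∷ ∧-conicalʳ _ _ x ∷ g , d , p , s)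
sound (∧R1 {φ = φ} D E) v (g , x ∷ d , p , s) with ∧-≡-false⁻ (holds v φ) x
... | inj₁ a = sound D v (g , a ∷ d , p , s)
... | inj₂ b = sound E v (g , b ∷ d , p , s)
sound (∧L2 D) v (g , d , x ∷ p , s) =
  sound D v (g , d , ∨-conicalˡ _ _ x ∷ ∨-conicalʳ _ _ x ∷ p , s)
sound (∧R2 {φ = φ} D E) v (g , d , p , x ∷ s) with ∨-≡-true⁻ (fails v φ) x
... | inj₁ a = sound D v (g , d , p , a ∷ s)
... | inj₂ b = sound E v (g , d , p , b ∷ s)
sound (∨R1 D) v (g , x ∷ d , p , s) =
  sound D v (g , ∨-conicalˡ _ _ x ∷ ∨-conicalʳ _ _ x ∷ d , p , s)
sound (∨L1 {φ = φ} D E) v (x ∷ g , d , p , s) with ∨-≡-true⁻ (holds v φ) x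
... | inj₁ a = sound D v (a ∷ g , d , p , s)
... | inj₂ b = sound E v (b ∷ g , d , p , s)
sound (∨R2 D) v (g , d , p , x ∷ s) =
  sound D v (g , d , p , ∧-conicalˡ _ _ x ∷ ∧-conicalʳ _ _ x ∷ s)
sound (∨L2 {φ = φ} D E) v (g , d , x ∷ p , s) with ∧-≡-false⁻ (fails v φ) x
... | inj₁ a = sound D v (g , d , a ∷ p , s)
... | inj₂ b = sound E v (g , d , b ∷ p , s)
sound (→R1 D) v (g , x ∷ d , p , s) =
  sound D v (g , ∨-conicalʳ _ _ x ∷ d , ∨-conicalˡ _ _ x ∷ p , s)
sound (→R2 D) v (g , d , p , x ∷ s) =
  sound D v (∧-conicalˡ _ _ x ∷ g , d , p , ∧-conicalʳ _ _ x ∷ s)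
sound (→L1 {φ = φ} D E) v (x ∷ g , d , p , s) with ∨-≡-true⁻ (fails v φ) x
... | inj₁ a = sound D v (g , d , p , a ∷ s)
... | inj₂ b = sound E v (b ∷ g , d , p , s)
sound (→L2 {φ = φ} D E) v (g , d , x ∷ p , s) with ∧-≡-false⁻ (holds v φ) x
... | inj₁ a = sound D v (g , a ∷ d , p , s)
... | inj₂ b = sound E v (g , d , b ∷ p , s)

mainTheorem2 : (Γ : List Formula) (φ : Formula) →
    ⊢BSC (Γ ⇒ φ ∷ [] ∣ [] ⇒ []) → Γ ⊨K3 φ
mainTheorem2 Γ φ D v Γ-true with holds v φ in φ-holds
... | true  = is1⇒≡v1 (eval v φ) (trans (is1-eval v φ) φ-holds)
... | false = ⊥-elim (sound D v (Γ-holds , φ-holds ∷ [] , [] , []))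
  where
  Γ-holds : All (λ γ → holds v γ ≡ true) Γ
  Γ-holds = All.tabulate λ {γ} γ∈Γ → trans (sym (is1-eval v γ)) (cong is1 (Γ-true γ γ∈Γ))
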